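{- Let $D$ be a plane oriented graph, $F$ a face of $D$, and $P=[w_1,w_r]$ an interval dipath of $F$ from a local source $S$ to a local sink $T$ (so that the angle $w_0$ preceding $w_1$ on the boundary belongs to $S$ and the angle $w_{r+1}$ following $w_r$ belongs to $T$). Then: (1) for any vertices $s\in S$, $t\in T$ and any angle $w_i$ of $P$, there exists a directed path in $D$ from $s$ to (the vertex of) $w_i$ and one from $w_i$ to $t$; (2) for any $i,j\in[1,r]$ with $i<j$, there exists a directed path in $D$ from $w_i$ to $w_j$.
   Context: An oriented graph has no loops, parallel arcs or digons; plane means given with a fixed plane embedding. An angle of a face $F$ is a triple $\widehat{e v e'}$ of a vertex $v$ and its two consecutive arcs $e,e'$ along the boundary of $F$. The boundary of $F$ is the cyclic list $(w_1,\dots,w_r)$ of its angles following the closed walk around $F$ clockwise; the vertex of an angle may repeat. An interval $[w_i,w_j]$ is the clockwise subwalk from $w_i$ to $w_j$. A strong interval of $F$ is a maximal interval all of whose vertices belong to the same strong component of $D$. A local terminal of $F$ is a strong interval $I=[w_i,w_j]$ such that either the boundary arc preceding $w_i$ and the boundary arc following $w_j$ are both directed out of $I$ (then $I$ is a local source), or both directed into $I$ (then $I$ is a local sink). An interval dipath of $F$ is a maximal interval of the boundary not intersecting any local terminal; it is contiguous to a local source on one side and a local sink on the other, and is said to be from that local source to that local sink, indexed left to right from the source side. -}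

module Defs where

open import Data.Nat using (ℕ; zero; suc; _+_; _*_; _≤_; _<_; _≤ᵇ_; pred)
open import Data.Nat.Properties using ()
open import Data.Fin using (Fin; toℕ)
open import Data.Fin.Properties using () renaming (_≟_ to _≟F_)
open import Data.Bool using (Bool; true; false; not; _∨_; if_then_else_)
open import Data.Bool.Properties using () renaming (_≟_ to _≟B_)
open import Data.Product using (Σ; ∃; ∃-syntax; _×_; _,_; proj₁; proj₂)
open import Data.Product.Properties using (≡-dec)
open import Data.Sum using (_⊎_)
open import Data.Empty using (⊥)
open import Data.List using (List; []; _∷_; concatMap; allFin; length; map)
open import Data.Bool.ListAction using (all; any)
open import Data.Nat.ListAction using (sum)
open import Relation.Nullary using (¬_)
open import Relation.Nullary.Decidable using (⌊_⌋)
open import Relation.Binary.PropositionalEquality using (_≡_; _≢_)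
open import Relation.Binary.Construct.Closure.ReflexiveTransitive using (Star)

_^[_]_ : {A : Set} → (A → A) → ℕ → A → A
f ^[ zero ] x = x
f ^[ suc k ] x = f (f ^[ k ] x)

-- Darts (half-arcs).  A dart (e , true) is the end of arc e at its tail,
-- (e , false) the end of arc e at its head.

Dart : ℕ → Set
Dart m = Fin m × Bool

_≟D_ : {m : ℕ} → (x y : Dart m) → Relation.Nullary.Dec (x ≡ y)
_≟D_ = ≡-dec _≟F_ _≟B_

α : {m : ℕ} → Dart m → Dart m
α (e , b) = (e , not b)

dartVertex : {n m : ℕ} → (tail head : Fin m → Fin n) → Dart m → Fin n
dartVertex tail head (e , true)  = tail e
dartVertex tail head (e , false) = head e

allDarts : (m : ℕ) → List (Dart m)
allDarts m = concatMap (λ e → (e , true) ∷ (e , false) ∷ []) (allFin m)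

dartIndex : {m : ℕ} → Dart m → ℕ
dartIndex (e , b) = 2 * toℕ e + (if b then 1 else 0)

reachB : {m : ℕ} → List (Dart m → Dart m) → ℕ → Dart m → Dart m → Bool
reachB gs zero x y = ⌊ x ≟D y ⌋
reachB gs (suc k) x y = reachB gs k x y ∨ any (λ g → reachB gs k (g x) y) gs

-- number of orbits of the group generated by the permutations gs
-- acting on the darts (count the darts of least index in their orbit)
orbitCount : (m : ℕ) → List (Dart m → Dart m) → ℕ
orbitCount m gs = sum (map (λ x → if isMin x then 1 else 0) (allDarts m))
  where
  isMin : Dart m → Bool
  isMin x = all (λ y → not (reachB gs (length (allDarts m)) y x)
                       ∨ (dartIndex x ≤ᵇ dartIndex y)) (allDarts m)

-- Plane oriented graphs, given combinatorially by a rotation system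
-- (combinatorial map) of genus 0.

record PlaneOrientedGraph : Set where
  field
    n m        : ℕ
    tail head  : Fin m → Fin n
    noLoop     : ∀ e → tail e ≢ head e
    noParallel : ∀ e e' → tail e ≡ tail e' → head e ≡ head e' → e ≡ e'
    noDigon    : ∀ e e' → tail e ≡ head e' → head e ≡ tail e' → ⊥
    -- rotation: a permutation of the darts (clockwise order around vertices)
    σ σ⁻¹      : Dart m → Dart m
    σσ⁻¹       : ∀ d → σ (σ⁻¹ d) ≡ d
    σ⁻¹σ       : ∀ d → σ⁻¹ (σ d) ≡ d
    σ-vertex   : ∀ d → dartVertex tail head (σ d) ≡ dartVertex tail head d
    σ-cyclic   : ∀ d d' → dartVertex tail head d ≡ dartVertex tail head d'
                   → ∃[ k ] σ ^[ k ] d ≡ d'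
    -- planarity (genus 0): Euler's formula V - E + F = 2C for the map
    -- (V = non-isolated vertices = σ-orbits, F = facial walks = φ-orbits,
    --  C = connected components = orbits of ⟨σ , α⟩)
    euler      : orbitCount m (σ ∷ []) + orbitCount m ((λ d → σ (α d)) ∷ [])
                   ≡ m + 2 * orbitCount m (σ ∷ α ∷ [])

module _ (D : PlaneOrientedGraph) where
  open PlaneOrientedGraph D

  Vertex : Set
  Vertex = Fin n

  vert : Dart m → Vertex
  vert = dartVertex tail head

  Arc : Vertex → Vertex → Set
  Arc u v = ∃[ e ] (tail e ≡ u × head e ≡ v)

  DiPath : Vertex → Vertex → Set
  DiPath = Star Arc

  SameStrongComponent : Vertex → Vertex → Set
  SameStrongComponent u v = DiPath u v × DiPath v u

  -- Faces = φ-orbits.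
  -- An angle of a face is identified with the dart leaving it; the
  -- angle of dart x sits at vert x, between the arcs of φ⁻¹ x and x.
  φ : Dart m → Dart m
  φ x = σ (α x)

  InFace : Dart m → Dart m → Set
  InFace f y = ∃[ k ] φ ^[ k ] f ≡ y

  IsInterval : Dart m → ℕ → Set
  IsInterval x ℓ = 1 ≤ ℓ × (∀ i j → i < ℓ → j < ℓ → φ ^[ i ] x ≡ φ ^[ j ] x → i ≡ j)

  _∈I_,_ : Dart m → Dart m → ℕ → Set
  z ∈I x , ℓ = ∃[ k ] (k < ℓ × φ ^[ k ] x ≡ z)

  _,_⊆I_,_ : Dart m → ℕ → Dart m → ℕ → Set
  x , ℓ ⊆I y , ℓ' = ∃[ j ] (j + ℓ ≤ ℓ' × φ ^[ j ] y ≡ x)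

  AllSameComponent : Dart m → ℕ → Set
  AllSameComponent x ℓ = ∀ i j → i < ℓ → j < ℓ →
    SameStrongComponent (vert (φ ^[ i ] x)) (vert (φ ^[ j ] x))

  IsStrongInterval : Dart m → Dart m → ℕ → Set
  IsStrongInterval f x ℓ =
    InFace f x × IsInterval x ℓ × AllSameComponent x ℓ ×
    (∀ y ℓ' → IsInterval y ℓ' → AllSameComponent y ℓ' →
       x , ℓ ⊆I y , ℓ' → ℓ' ≡ ℓ)

  IsOut : Dart m → Set
  IsOut x = proj₂ x ≡ true

  IsIn : Dart m → Set
  IsIn x = proj₂ x ≡ false

  -- The arc preceding the first angle x is the arc of σ⁻¹ x (the dart of
  -- that arc at vert x); the arc following the last angle φ^(ℓ-1) x is
  -- the arc of the dart φ^(ℓ-1) x.  Local terminals are proper subwalks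
  -- (IsInterval x (suc ℓ): fewer angles than the whole boundary).
  IsLocalSource : Dart m → Dart m → ℕ → Set
  IsLocalSource f x ℓ = IsStrongInterval f x ℓ × IsInterval x (suc ℓ) ×
    IsOut (σ⁻¹ x) × IsOut (φ ^[ pred ℓ ] x)

  IsLocalSink : Dart m → Dart m → ℕ → Set
  IsLocalSink f x ℓ = IsStrongInterval f x ℓ × IsInterval x (suc ℓ) ×
    IsIn (σ⁻¹ x) × IsIn (φ ^[ pred ℓ ] x)

  IsLocalTerminal : Dart m → Dart m → ℕ → Set
  IsLocalTerminal f x ℓ = IsLocalSource f x ℓ ⊎ IsLocalSink f x ℓ

  AvoidsTerminals : Dart m → Dart m → ℕ → Set
  AvoidsTerminals f p r = ∀ z y ℓ → IsLocalTerminal f y ℓ →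
    z ∈I p , r → ¬ (z ∈I y , ℓ)

  -- interval dipath P = (p , r) of F from the local source S = (xS , ℓS)
  -- to the local sink T = (xT , ℓT): a maximal interval not meeting any
  -- local terminal, whose preceding angle φ⁻¹ p = α (σ⁻¹ p) lies in S and
  -- whose following angle φ^r p lies in T
  IsIntervalDipath : Dart m → Dart m → ℕ → Dart m → ℕ → Dart m → ℕ → Set
  IsIntervalDipath f xS ℓS xT ℓT p r =
    InFace f p × IsInterval p r × AvoidsTerminals f p r ×
    (∀ q r' → IsInterval q r' → AvoidsTerminals f q r' →
       p , r ⊆I q , r' → r' ≡ r) ×
    IsLocalSource f xS ℓS × IsLocalSink f xT ℓT ×
    (α (σ⁻¹ p)) ∈I xS , ℓS × (φ ^[ r ] p) ∈I xT , ℓT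

  IsVertexOf : Vertex → Dart m → ℕ → Set
  IsVertexOf v x ℓ = ∃[ k ] (k < ℓ × vert (φ ^[ k ] x) ≡ v)

{-# OPTIONS --safe #-}
-- Walk along the boundary of F from the last angle of S through P to the first angle of T.
-- Every arc on the way is traversed forwards or joins two vertices of one strong component:
-- otherwise take the first backward arc between two components; the stretch of the walk
-- since the previous change of component is entered by a forward arc (ultimately the arc
-- leaving the local source S), so it is a local sink inside P, which P avoids. Consecutive
-- vertices of the walk are therefore joined by dipaths, and each of S, T lies in a single
-- strong component.
module Submission where

open import Defs
open import Data.Bool using (true; false; not)
open import Data.Empty using (⊥; ⊥-elim)
open import Data.Fin using (Fin; _≟_)
open import Data.Fin.Properties using (any?)
open import Data.List using (List; []; _∷_; allFin)
open import Data.List.Membership.Propositional using (_∈_)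
open import Data.List.Membership.Propositional.Properties using (∈-allFin)
open import Data.List.Relation.Unary.Any using (here; there)
open import Data.Nat using (ℕ; zero; suc; pred; _+_; _<_; _≤_; z≤n; s≤s)
open import Data.Nat.Properties
  using (+-suc; +-comm; +-cancelʳ-≡; +-monoˡ-<; ≤-refl; ≤-trans; ≤-reflexive; ≤-pred; ≤-<-trans;
         <⇒≤; m<m+n; m<n⇒m<1+n; n<1+n; n≤1+n; m≤n+m; 1+n≢n; m≤n⇒m<n∨m≡n; m<1+n⇒m<n∨m≡n)
open import Data.Product using (∃-syntax; _×_; _,_; proj₁; proj₂; map₂)
open import Data.Sum using (_⊎_; inj₁; inj₂)
open import Function using (_∘_)
open import Level using (Level)
open import Relation.Binary.Core using (Rel)
open import Relation.Binary.Definitions using (Decidable)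
open import Relation.Binary.PropositionalEquality using (_≡_; refl; sym; trans; cong; subst; subst₂)
open import Relation.Binary.Construct.Closure.ReflexiveTransitive using (Star; ε; _◅_; _◅◅_; map)
open import Relation.Nullary using (¬_; Dec; yes; no)
open import Relation.Nullary.Decidable using (_×-dec_; _⊎-dec_; map′)

module FiniteReachability {ℓ : Level} {n : ℕ} {_⟶_ : Rel (Fin n) ℓ} (_⟶?_ : Decidable _⟶_) where

  -- Paths all of whose vertices after the first lie in A; induction on A decides them
  -- as in the Floyd–Warshall algorithm.
  Into : List (Fin n) → Rel (Fin n) ℓ
  Into A u v = u ⟶ v × v ∈ A

  Through : List (Fin n) → Rel (Fin n) ℓ
  Through A = Star (Into A)

  through-[] : ∀ {u v} → Through [] u v → u ≡ v
  through-[] ε = refl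
  through-[] ((_ , ()) ◅ _)

  through-∷⁺ : ∀ {a A u v} → Through A u v → Through (a ∷ A) u v
  through-∷⁺ = map (map₂ there)

  split-at-last : ∀ {a A u v} → Through (a ∷ A) u v →
    Through A u v ⊎ (Through (a ∷ A) u a × Through A a v)
  split-at-last ε = inj₁ ε
  split-at-last (e ◅ π) with split-at-last π
  split-at-last ((e , here refl) ◅ π) | inj₁ π′ = inj₂ ((e , here refl) ◅ ε , π′)
  split-at-last ((e , there v∈A) ◅ π) | inj₁ π′ = inj₁ ((e , v∈A) ◅ π′)
  split-at-last (e ◅ π)               | inj₂ (ρ , π′) = inj₂ (e ◅ ρ , π′)

  split-at-first : ∀ {a A u} → Through (a ∷ A) u a →
    u ≡ a ⊎ ∃[ y ] (Through A u y × y ⟶ a)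
  split-at-first ε = inj₁ refl
  split-at-first {u = u} ((e , here refl) ◅ π) = inj₂ (u , ε , e)
  split-at-first {u = u} ((e , there v∈A) ◅ π) with split-at-first π
  ... | inj₁ refl = inj₂ (u , ε , e)
  ... | inj₂ (y , ρ , e′) = inj₂ (y , (e , v∈A) ◅ ρ , e′)

  through? : ∀ A → Decidable (Through A)
  through? [] u v = map′ (λ { refl → ε }) through-[] (u ≟ v)
  through? (a ∷ A) u v =
    map′ join split
      (through? A u v ⊎-dec (any? (λ y → through? A u y ×-dec y ⟶? a) ×-dec through? A a v))
    where
    Decomposed : Set ℓ
    Decomposed = Through A u v ⊎ ((∃[ y ] (Through A u y × y ⟶ a)) × Through A a v)

    join : Decomposed → Through (a ∷ A) u v
    join (inj₁ π) = through-∷⁺ π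
    join (inj₂ ((y , π , e) , ρ)) = through-∷⁺ π ◅◅ (e , here refl) ◅ through-∷⁺ ρ

    split : Through (a ∷ A) u v → Decomposed
    split π with split-at-last π
    ... | inj₁ π′ = inj₁ π′
    ... | inj₂ (ρ , π′) with split-at-first ρ
    ...   | inj₁ refl = inj₁ π′
    ...   | inj₂ hit = inj₂ (hit , π′)

  star? : Decidable (Star _⟶_)
  star? u v = map′ (map proj₁) (map (λ e → e , ∈-allFin _)) (through? (allFin n) u v)

Star-stepwise : ∀ {a ℓ} {A : Set a} {R : Rel A ℓ} (v : ℕ → A) {N : ℕ} →
  (∀ j → j < N → Star R (v j) (v (suc j))) →
  ∀ {i j} → i ≤ j → j ≤ N → Star R (v i) (v j)
Star-stepwise v step {j = zero} z≤n _ = ε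
Star-stepwise v step {j = suc j} i≤j j<N with m≤n⇒m<n∨m≡n i≤j
... | inj₁ i<j = Star-stepwise v step {j = j} (≤-pred i<j) (<⇒≤ j<N) ◅◅ step j j<N
... | inj₂ refl = ε

^-+ : ∀ {A : Set} (f : A → A) i j x → f ^[ i + j ] x ≡ f ^[ i ] (f ^[ j ] x)
^-+ f zero j x = refl
^-+ f (suc i) j x = cong f (^-+ f i j x)

^-suc : ∀ {A : Set} (f : A → A) i x → f ^[ suc i ] x ≡ f ^[ i ] (f x)
^-suc f zero x = refl
^-suc f (suc i) x = cong f (^-suc f i x)

α-involutive : ∀ {m} (x : Dart m) → α (α x) ≡ x
α-involutive (e , true) = refl
α-involutive (e , false) = refl

module _ (D : PlaneOrientedGraph) where
  open PlaneOrientedGraph D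

  φ⁻¹ : Dart m → Dart m
  φ⁻¹ x = α (σ⁻¹ x)

  φ-φ⁻¹ : ∀ x → φ D (φ⁻¹ x) ≡ x
  φ-φ⁻¹ x = trans (cong σ (α-involutive (σ⁻¹ x))) (σσ⁻¹ x)

  φ⁻¹-φ : ∀ x → φ⁻¹ (φ D x) ≡ x
  φ⁻¹-φ x = trans (cong α (σ⁻¹σ (α x))) (α-involutive x)

  φ-injective : ∀ {x y} → φ D x ≡ φ D y → x ≡ y
  φ-injective {x} {y} eq = trans (sym (φ⁻¹-φ x)) (trans (cong φ⁻¹ eq) (φ⁻¹-φ y))

  φ^-φ⁻¹ : ∀ i x → φ D ^[ suc i ] (φ⁻¹ x) ≡ φ D ^[ i ] x
  φ^-φ⁻¹ i x = trans (^-suc (φ D) i (φ⁻¹ x)) (cong (φ D ^[ i ]_) (φ-φ⁻¹ x))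

  φ⁻¹-φ^ : ∀ i x → φ⁻¹ (φ D ^[ i ] x) ≡ φ D ^[ i ] (φ⁻¹ x)
  φ⁻¹-φ^ zero x = refl
  φ⁻¹-φ^ (suc i) x = trans (φ⁻¹-φ _) (sym (φ^-φ⁻¹ i x))

  InFace-φ^ : ∀ {f x} j → InFace D f x → InFace D f (φ D ^[ j ] x)
  InFace-φ^ {f} j (k , eq) = j + k , trans (^-+ (φ D) j k f) (cong (φ D ^[ j ]_) eq)

  out-arc : ∀ {x} → IsOut D x → Arc D (vert D x) (vert D (φ D x))
  out-arc {e , true} refl = e , refl , sym (σ-vertex (e , false))

  out-or-in : ∀ x → IsOut D x ⊎ IsIn D x
  out-or-in (_ , true) = inj₁ refl
  out-or-in (_ , false) = inj₂ refl

  out⇒in-σ⁻¹φ : ∀ {x} → IsOut D x → IsIn D (σ⁻¹ (φ D x))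
  out⇒in-σ⁻¹φ {x} out = trans (cong proj₂ (σ⁻¹σ (α x))) (cong not out)

  in-σ⁻¹⇒out-φ⁻¹ : ∀ {x} → IsIn D (σ⁻¹ x) → IsOut D (φ⁻¹ x)
  in-σ⁻¹⇒out-φ⁻¹ = cong not

  Same : Vertex D → Vertex D → Set
  Same = SameStrongComponent D

  same-refl : ∀ {u} → Same u u
  same-refl = ε , ε

  same-sym : ∀ {u v} → Same u v → Same v u
  same-sym (uv , vu) = vu , uv

  same-trans : ∀ {u v w} → Same u v → Same v w → Same u w
  same-trans (uv , vu) (vw , wv) = uv ◅◅ vw , wv ◅◅ vu

  Internal : Dart m → Set
  Internal x = Same (vert D x) (vert D (φ D x))

  internal? : ∀ x → Dec (Internal x)
  internal? x = star? (vert D x) (vert D (φ D x)) ×-dec star? (vert D (φ D x)) (vert D x)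
    where
    open FiniteReachability (λ u v → any? (λ e → (tail e ≟ u) ×-dec (head e ≟ v)))

  IsStrongInterval⇒Same : ∀ {f x ℓ u z} → IsStrongInterval D f x ℓ →
    IsVertexOf D u x ℓ → _∈I_,_ D z x ℓ → Same u (vert D z)
  IsStrongInterval⇒Same (_ , _ , all , _) (i , i<ℓ , refl) (j , j<ℓ , refl) = all i j i<ℓ j<ℓ

  AllSameComponent-chain : ∀ {x ℓ} → (∀ i → i < ℓ → Internal (φ D ^[ i ] x)) →
    AllSameComponent D x (suc ℓ)
  AllSameComponent-chain {x} {ℓ} chain i j i≤ℓ j≤ℓ =
    same-trans (same-sym (from-start i (≤-pred i≤ℓ))) (from-start j (≤-pred j≤ℓ))
    where
    from-start : ∀ i → i ≤ ℓ → Same (vert D x) (vert D (φ D ^[ i ] x))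
    from-start zero _ = same-refl
    from-start (suc i) i<ℓ = same-trans (from-start i (<⇒≤ i<ℓ)) (chain i i<ℓ)

  AllSameComponent⇒internal : ∀ {x ℓ} → AllSameComponent D x (suc ℓ) →
    ∀ i → i < ℓ → Internal (φ D ^[ i ] x)
  AllSameComponent⇒internal all i i<ℓ = all i (suc i) (m<n⇒m<1+n i<ℓ) (s≤s i<ℓ)

  IsInterval-sub : ∀ {x ℓ ℓ′} j → IsInterval D x ℓ → 1 ≤ ℓ′ → j + ℓ′ ≤ ℓ →
    IsInterval D (φ D ^[ j ] x) ℓ′
  IsInterval-sub {x} {ℓ} {ℓ′} j (_ , distinct) 1≤ℓ′ j+ℓ′≤ℓ =
    1≤ℓ′ , λ i k i<ℓ′ k<ℓ′ eq →
    +-cancelʳ-≡ j i k (distinct (i + j) (k + j) (shift i<ℓ′) (shift k<ℓ′)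
      (trans (^-+ (φ D) i j x) (trans eq (sym (^-+ (φ D) k j x)))))
    where
    shift : ∀ {i} → i < ℓ′ → i + j < ℓ
    shift i<ℓ′ = ≤-trans (+-monoˡ-< j i<ℓ′) (≤-trans (≤-reflexive (+-comm ℓ′ j)) j+ℓ′≤ℓ)

  IsStrongInterval-intro : ∀ {f x ℓ} → InFace D f x → IsInterval D x (suc ℓ) →
    (∀ i → i < ℓ → Internal (φ D ^[ i ] x)) →
    ¬ Internal (φ⁻¹ x) → ¬ Internal (φ D ^[ ℓ ] x) → IsStrongInterval D f x (suc ℓ)
  IsStrongInterval-intro {f} {x} {ℓ} x∈F interval chain ¬entry ¬exit =
    x∈F , interval , AllSameComponent-chain chain , maximal
    where
    maximal : ∀ y ℓ′ → IsInterval D y ℓ′ → AllSameComponent D y ℓ′ →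
      _,_⊆I_,_ D x (suc ℓ) y ℓ′ → ℓ′ ≡ suc ℓ
    maximal y ℓ′ _ all (zero , ℓ<ℓ′ , refl) with m≤n⇒m<n∨m≡n ℓ<ℓ′
    ... | inj₂ eq = sym eq
    ... | inj₁ sℓ<ℓ′ = ⊥-elim (¬exit (all ℓ (suc ℓ) (<⇒≤ sℓ<ℓ′) sℓ<ℓ′))
    maximal y ℓ′ _ all (suc j , sj+sℓ≤ℓ′ , eq) =
      ⊥-elim (¬entry (subst Internal φ^jy≡φ⁻¹x (all j (suc j) (<⇒≤ sj<ℓ′) sj<ℓ′)))
      where
      sj<ℓ′ : suc j < ℓ′
      sj<ℓ′ = ≤-trans (s≤s (m<m+n j (s≤s z≤n))) sj+sℓ≤ℓ′
      φ^jy≡φ⁻¹x : φ D ^[ j ] y ≡ φ⁻¹ x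
      φ^jy≡φ⁻¹x = φ-injective (trans eq (sym (φ-φ⁻¹ x)))

  IsStrongInterval⇒¬internal-exit : ∀ {f x c} → IsStrongInterval D f x (suc c) →
    IsInterval D x (suc (suc c)) → ¬ Internal (φ D ^[ c ] x)
  IsStrongInterval⇒¬internal-exit {x = x} {c} (_ , _ , all , maximal) longer internal =
    1+n≢n (maximal x (suc (suc c)) longer (AllSameComponent-chain chain) (0 , n≤1+n _ , refl))
    where
    chain : ∀ i → i < suc c → Internal (φ D ^[ i ] x)
    chain i i<sc with m<1+n⇒m<n∨m≡n i<sc
    ... | inj₁ i<c = AllSameComponent⇒internal all i i<c
    ... | inj₂ refl = internal

  IsLocalSource⇒exit : ∀ {f x ℓ} → IsLocalSource D f x ℓ →
    IsOut D (φ D ^[ pred ℓ ] x) × ¬ Internal (φ D ^[ pred ℓ ] x)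
  IsLocalSource⇒exit (strong@(_ , (s≤s z≤n , _) , _) , longer , _ , out) =
    out , IsStrongInterval⇒¬internal-exit strong longer

  IsLocalSink⇒entry : ∀ {f x ℓ} → IsLocalSink D f x ℓ → IsOut D (φ⁻¹ x)
  IsLocalSink⇒entry (_ , _ , in-entry , _) = in-σ⁻¹⇒out-φ⁻¹ in-entry

  IsLocalSink-intro : ∀ {f y ℓ} → InFace D f y → IsInterval D y (suc (suc ℓ)) →
    (∀ i → i < ℓ → Internal (φ D ^[ i ] y)) →
    ¬ Internal (φ⁻¹ y) → ¬ Internal (φ D ^[ ℓ ] y) →
    IsIn D (σ⁻¹ y) → IsIn D (φ D ^[ ℓ ] y) → IsLocalSink D f y (suc ℓ)
  IsLocalSink-intro y∈F longer chain ¬entry ¬exit in-entry in-exit =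
    IsStrongInterval-intro y∈F (IsInterval-sub 0 longer (s≤s z≤n) (n≤1+n _)) chain ¬entry ¬exit ,
    longer , in-entry , in-exit

  ∈I-last : ∀ {x ℓ y} → _∈I_,_ D (φ⁻¹ y) x ℓ → ¬ _∈I_,_ D y x ℓ → φ D ^[ pred ℓ ] x ≡ φ⁻¹ y
  ∈I-last {y = y} (c , c<ℓ , eq) y∉ with m≤n⇒m<n∨m≡n c<ℓ
  ... | inj₂ refl = eq
  ... | inj₁ sc<ℓ = ⊥-elim (y∉ (suc c , sc<ℓ , trans (cong (φ D) eq) (φ-φ⁻¹ y)))

  ∈I-first : ∀ {x ℓ y} → _∈I_,_ D y x ℓ → ¬ _∈I_,_ D (φ⁻¹ y) x ℓ → x ≡ y
  ∈I-first (zero , _ , eq) _ = eq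
  ∈I-first {y = y} (suc c , sc<ℓ , eq) pre∉ =
    ⊥-elim (pre∉ (c , <⇒≤ sc<ℓ , φ-injective (trans eq (sym (φ-φ⁻¹ y)))))

  module FaceWalk {f p : Dart m} {r : ℕ} (p∈F : InFace D f p) (P-interval : IsInterval D p r)
    (no-sink-in-P : ∀ y ℓ → IsLocalSink D f y ℓ → ¬ _∈I_,_ D y p r)
    (source-exit : IsOut D (φ⁻¹ p) × ¬ Internal (φ⁻¹ p))
    (sink-entry : IsOut D (φ⁻¹ (φ D ^[ r ] p))) where

    -- w 0 is the angle of S before P, w (suc i) the angle i of P, w (suc r) the angle of T
    -- after P; step j of the walk is the boundary arc from w j to w (suc j).
    w : ℕ → Dart m
    w j = φ D ^[ j ] (φ⁻¹ p)

    w-suc : ∀ i → w (suc i) ≡ φ D ^[ i ] p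
    w-suc i = φ^-φ⁻¹ i p

    w-shift : ∀ g b {k} → g + b ≡ k → φ D ^[ g ] (w (suc b)) ≡ w (suc k)
    w-shift g b refl =
      trans (sym (^-+ (φ D) g (suc b) (φ⁻¹ p))) (cong (λ i → φ D ^[ i ] (φ⁻¹ p)) (+-suc g b))

    last-out : IsOut D (w r)
    last-out = subst (IsOut D) (φ⁻¹-φ^ r p) sink-entry

    -- Step b is a forward change of strong component and steps b + 1, …, b + g = k are not.
    LastExitForward : ℕ → Set
    LastExitForward k = ∃[ b ] ∃[ g ] (g + b ≡ k × IsOut D (w b) × ¬ Internal (w b) ×
      (∀ i → i < g → Internal (φ D ^[ i ] (w (suc b)))))

    ¬backward-exit : ∀ {k} → LastExitForward k → suc k < r →
      IsIn D (w (suc k)) → ¬ Internal (w (suc k)) → ⊥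
    ¬backward-exit (b , g , refl , out , ¬internal , chain) sk<r in-exit ¬exit =
      no-sink-in-P (w (suc b)) (suc g) sink (b , b<r , sym (w-suc b))
      where
      b<r : b < r
      b<r = ≤-<-trans (m≤n+m b g) (<⇒≤ sk<r)
      sink : IsLocalSink D f (w (suc b)) (suc g)
      sink = IsLocalSink-intro
        (subst (InFace D f) (sym (w-suc b)) (InFace-φ^ b p∈F))
        (subst (λ y → IsInterval D y (suc (suc g))) (sym (w-suc b))
          (IsInterval-sub b P-interval (s≤s z≤n)
            (≤-trans (≤-reflexive (+-comm b (suc (suc g)))) sk<r)))
        chain
        (¬internal ∘ subst Internal (φ⁻¹-φ (w b)))
        (¬exit ∘ subst Internal (w-shift g b refl))
        (out⇒in-σ⁻¹φ out)
        (subst (IsIn D) (sym (w-shift g b refl)) in-exit)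

    LastExitForward-suc : ∀ {k} → LastExitForward k → suc k ≤ r → LastExitForward (suc k)
    LastExitForward-suc {k} last@(b , g , g+b≡k , out , ¬internal , chain) sk≤r
      with internal? (w (suc k))
    ... | yes internal = b , suc g , cong suc g+b≡k , out , ¬internal , chain′
      where
      chain′ : ∀ i → i < suc g → Internal (φ D ^[ i ] (w (suc b)))
      chain′ i i<sg with m<1+n⇒m<n∨m≡n i<sg
      ... | inj₁ i<g = chain i i<g
      ... | inj₂ refl = subst Internal (sym (w-shift g b g+b≡k)) internal
    ... | no ¬internal′ with out-or-in (w (suc k))
    ...   | inj₁ out′ = suc k , 0 , refl , out′ , ¬internal′ , λ _ ()
    ...   | inj₂ in′ with m≤n⇒m<n∨m≡n sk≤r
    ...     | inj₁ sk<r = ⊥-elim (¬backward-exit last sk<r in′ ¬internal′)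
    ...     | inj₂ sk≡r with trans (sym last-out) (subst (λ j → IsIn D (w j)) sk≡r in′)
    ...       | ()

    last-exit-forward : ∀ k → k ≤ r → LastExitForward k
    last-exit-forward zero _ = 0 , 0 , refl , proj₁ source-exit , proj₂ source-exit , λ _ ()
    last-exit-forward (suc k) sk≤r = LastExitForward-suc (last-exit-forward k (<⇒≤ sk≤r)) sk≤r

    out-or-internal : ∀ {k} → LastExitForward k → IsOut D (w k) ⊎ Internal (w k)
    out-or-internal (b , zero , refl , out , _) = inj₁ out
    out-or-internal (b , suc g , refl , _ , _ , chain) =
      inj₂ (subst Internal (w-shift g b refl) (chain g (n<1+n g)))

    w-step : ∀ j → j ≤ r → DiPath D (vert D (w j)) (vert D (w (suc j)))
    w-step j j≤r with out-or-internal (last-exit-forward j j≤r)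
    ... | inj₁ out = out-arc out ◅ ε
    ... | inj₂ internal = proj₁ internal

    w-path : ∀ {i j} → i ≤ j → j ≤ suc r → DiPath D (vert D (w i)) (vert D (w j))
    w-path = Star-stepwise (λ k → vert D (w k)) (λ k k<sr → w-step k (≤-pred k<sr))

    along-P : ∀ {i j} → i ≤ j → j ≤ r → DiPath D (vert D (φ D ^[ i ] p)) (vert D (φ D ^[ j ] p))
    along-P {i} {j} i≤j j≤r =
      subst₂ (DiPath D) (cong (vert D) (w-suc i)) (cong (vert D) (w-suc j))
        (w-path (s≤s i≤j) (s≤s j≤r))

    before-P : ∀ {j} → j ≤ r → DiPath D (vert D (φ⁻¹ p)) (vert D (φ D ^[ j ] p))
    before-P {j} j≤r =
      subst (DiPath D (vert D (φ⁻¹ p))) (cong (vert D) (w-suc j)) (w-path z≤n (s≤s j≤r))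

  module _ {f p : Dart m} {r : ℕ} (avoids : AvoidsTerminals D f p r) where

    AvoidsTerminals⇒no-sink : ∀ y ℓ → IsLocalSink D f y ℓ → ¬ _∈I_,_ D y p r
    AvoidsTerminals⇒no-sink y ℓ sink@((_ , (1≤ℓ , _) , _) , _) y∈P =
      avoids y y ℓ (inj₂ sink) y∈P (0 , 1≤ℓ , refl)

    source-exit-before : ∀ {xS ℓS} → 1 ≤ r →
      IsLocalSource D f xS ℓS → _∈I_,_ D (φ⁻¹ p) xS ℓS →
      IsOut D (φ⁻¹ p) × ¬ Internal (φ⁻¹ p)
    source-exit-before {xS} {ℓS} 1≤r source pre∈S =
      subst (λ x → IsOut D x × ¬ Internal x)
        (∈I-last pre∈S (avoids p xS ℓS (inj₁ source) (0 , 1≤r , refl)))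
        (IsLocalSource⇒exit source)

    sink-entry-after : ∀ {xT ℓT} → 1 ≤ r →
      IsLocalSink D f xT ℓT → _∈I_,_ D (φ D ^[ r ] p) xT ℓT →
      IsOut D (φ⁻¹ (φ D ^[ r ] p))
    sink-entry-after {xT} {ℓT} (s≤s {n = r′} z≤n) sink end∈T =
      subst (λ x → IsOut D (φ⁻¹ x)) (∈I-first end∈T last∉T) (IsLocalSink⇒entry sink)
      where
      last∉T : ¬ _∈I_,_ D (φ⁻¹ (φ D ^[ suc r′ ] p)) xT ℓT
      last∉T pre∈T = avoids (φ D ^[ r′ ] p) xT ℓT (inj₂ sink) (r′ , ≤-refl , refl)
        (subst (λ z → _∈I_,_ D z xT ℓT) (φ⁻¹-φ _) pre∈T)

lemma5 : (D : PlaneOrientedGraph) →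
    (f xS xT p : Dart (PlaneOrientedGraph.m D)) (ℓS ℓT r : ℕ) →
    IsIntervalDipath D f xS ℓS xT ℓT p r →
    ((s t : Fin (PlaneOrientedGraph.n D)) →
       IsVertexOf D s xS ℓS → IsVertexOf D t xT ℓT →
       ∀ i → i < r →
       DiPath D s (vert D (φ D ^[ i ] p)) × DiPath D (vert D (φ D ^[ i ] p)) t) ×
    (∀ i j → i < j → j < r →
       DiPath D (vert D (φ D ^[ i ] p)) (vert D (φ D ^[ j ] p)))
lemma5 D f xS xT p ℓS ℓT r
  (p∈F , P-interval@(1≤r , _) , avoids , _ , source@(S , _) , sink@(T , _) , pre∈S , end∈T) =
  (λ s t s∈S t∈T i i<r →
     proj₁ (IsStrongInterval⇒Same D S s∈S pre∈S) ◅◅ before-P (<⇒≤ i<r) ,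
     along-P (<⇒≤ i<r) ≤-refl ◅◅ proj₂ (IsStrongInterval⇒Same D T t∈T end∈T)) ,
  λ i j i<j j<r → along-P (<⇒≤ i<j) (<⇒≤ j<r)
  where
  open FaceWalk D p∈F P-interval (AvoidsTerminals⇒no-sink D avoids)
    (source-exit-before D avoids 1≤r source pre∈S) (sink-entry-after D avoids 1≤r sink end∈T)
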